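{- Let $\mathfrak{F}$ be a CI frame closed under copying and marginalization. Then $N\mapsto\mathfrak{F}^{\mathrm{sa}}(N)$ defines a CI frame $\mathfrak{F}^{\mathrm{sa}}$ which is also closed under copying and marginalization. Moreover: (i) if $\mathfrak{F}$ is additionally closed under intersection, then so is $\mathfrak{F}^{\mathrm{sa}}$; (ii) if $\mathfrak{F}$ is additionally closed under lifting, then so is $\mathfrak{F}^{\mathrm{sa}}$; (iii) if $\mathfrak{F}$ is additionally closed under intersection, lifting, and ascetic extension, then so is $\mathfrak{F}^{\mathrm{sa}}$.
   Context: For a finite set $N$, $\mathbb{S}(N)$ denotes the set of all CI statements $ij|K$ with $i,j\in N$ distinct and $K\subseteq N\setminus\{i,j\}$, with $ij|K$ and $ji|K$ identified; juxtaposition denotes union. A CI model over $N$ is a subset of $\mathbb{S}(N)$ (also a model over any superset of $N$). A CI frame $\mathfrak{F}$ assigns to every finite set $N$ a set $\mathfrak{F}(N)$ of models over $N$ with $\mathbb{S}(N)\in\mathfrak{F}(N)$. Closure properties: copying (for bijections $\varphi:N\to M$ acting by $\varphi(ij|K)=\varphi(i)\varphi(j)|\varphi(K)$, $\mathcal{M}\in\mathfrak{F}(N)\Rightarrow\varphi(\mathcal{M})\in\mathfrak{F}(M)$); marginalization ($\mathcal{M}\in\mathfrak{F}(N)$, $M\subseteq N\Rightarrow\mathcal{M}^{\downarrow M}:=\mathcal{M}\cap\mathbb{S}(M)\in\mathfrak{F}(M)$); intersection ($\mathcal{M},\mathcal{A}\in\mathfrak{F}(N)\Rightarrow\mathcal{M}\cap\mathcal{A}\in\mathfrak{F}(N)$);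 lifting ($\mathcal{M}\in\mathfrak{F}(N)$, $N\subseteq O\Rightarrow\mathcal{M}_{N\uparrow O}\in\mathfrak{F}(O)$, where $\mathcal{M}_{N\uparrow O}=\{ij|K\in\mathbb{S}(O):\{i,j\}\cap(O\setminus N)\ne\emptyset\text{ or }ij|(K\cap N)\in\mathcal{M}\}$); ascetic extension ($N\subseteq M\Rightarrow\mathfrak{F}(N)\subseteq\mathfrak{F}(M)$). For pairwise disjoint $I,J,C$, $I\perp J\,|\,C\,[\mathcal{Z}]$ means $ij|L'\in\mathcal{Z}$ for all $i\in I$, $j\in J$, $C\subseteq L'\subseteq(I\cup J\cup C)\setminus\{i,j\}$. For a frame closed under copying and marginalization, $\mathcal{M}\in\mathfrak{F}(N)$ is self-adhesive at $L\subseteq N$ relative to $\mathfrak{F}$ if for every bijection $\varphi:N\to M$ with $N\cap M=L$ and $\varphi|_L=\mathrm{id}_L$ there is $\mathcal{Z}\in\mathfrak{F}(N\cup M)$ with $\mathcal{Z}^{\downarrow N}=\mathcal{M}$, $\mathcal{Z}^{\downarrow M}=\varphi(\mathcal{M})$, and $(N\setminus M)\perp(M\setminus N)\,|\,L\,[\mathcal{Z}]$. $\mathfrak{F}^{\mathrm{sa}}(N)$ is the set of $\mathcal{M}\in\mathfrak{F}(N)$ self-adhesive at every $L\subseteq N$ relative to $\mathfrak{F}$. -}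

module Defs where

open import Level using (0ℓ)
open import Data.Bool using (Bool; T)
open import Data.Nat using (ℕ; zero; suc; _<_; _%_; _/_; _≡ᵇ_; _⊓_; _⊔_)
open import Data.Product using (Σ; _×_; _,_; ∃; ∃-syntax)
open import Data.Sum using (_⊎_)
open import Relation.Nullary using (¬_)
open import Relation.Binary.PropositionalEquality using (_≡_; _≢_)
open import Relation.Unary using (Pred; _≐_; _∩_)
open import Function.Bundles using (_⇔_)

-- Ground elements ("random variables") are natural numbers.  A finite
-- set of natural numbers is encoded canonically by a natural number
-- (its characteristic bit vector): x ∈ N iff bit x of N is 1.
-- This encoding is a bijection between ℕ and finite subsets of ℕ, so
-- two codes denote the same set iff they are equal.

FinSet : Set
FinSet = ℕ

testBit : ℕ → ℕ → Bool
testBit n zero    = (n % 2) ≡ᵇ 1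
testBit n (suc x) = testBit (n / 2) x

infix 4 _∈ˢ_ _∉ˢ_ _⊆ˢ_

_∈ˢ_ : ℕ → FinSet → Set
x ∈ˢ N = T (testBit N x)

_∉ˢ_ : ℕ → FinSet → Set
x ∉ˢ N = ¬ (x ∈ˢ N)

_⊆ˢ_ : FinSet → FinSet → Set
A ⊆ˢ B = ∀ x → x ∈ˢ A → x ∈ˢ B

IsUnion : FinSet → FinSet → FinSet → Set
IsUnion U A B = ∀ x → x ∈ˢ U ⇔ (x ∈ˢ A ⊎ x ∈ˢ B)

IsInter : FinSet → FinSet → FinSet → Set
IsInter C A B = ∀ x → x ∈ˢ C ⇔ (x ∈ˢ A × x ∈ˢ B)

-- The statement ij|K = ji|K
-- is represented canonically by the triple with the smaller index first
-- (this is enforced by 𝕊 below).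

Stmt : Set
Stmt = ℕ × ℕ × FinSet

ci : ℕ → ℕ → FinSet → Stmt
ci i j K = (i ⊓ j , i ⊔ j , K)

Model : Set₁
Model = Pred Stmt 0ℓ

𝕊 : FinSet → Model
𝕊 N (i , j , K) = i < j × i ∈ˢ N × j ∈ˢ N × K ⊆ˢ N × i ∉ˢ K × j ∉ˢ K

_↓_ : Model → FinSet → Model
M ↓ N = M ∩ 𝕊 N

IsBij : (ℕ → ℕ) → FinSet → FinSet → Set
IsBij f N M =
  (∀ x → x ∈ˢ N → f x ∈ˢ M) ×
  (∀ x y → x ∈ˢ N → y ∈ˢ N → f x ≡ f y → x ≡ y) ×
  (∀ y → y ∈ˢ M → ∃[ x ] (x ∈ˢ N × f x ≡ y))

IsImage : (ℕ → ℕ) → FinSet → FinSet → Set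
IsImage f K K' = ∀ y → y ∈ˢ K' ⇔ (∃[ k ] (k ∈ˢ K × f k ≡ y))

copy : (ℕ → ℕ) → Model → Model
copy f M (a , b , K') =
  Σ ℕ λ i → Σ ℕ λ j → Σ FinSet λ K →
    M (i , j , K) × a < b ×
    ((a ≡ f i × b ≡ f j) ⊎ (a ≡ f j × b ≡ f i)) × IsImage f K K'

lift : FinSet → FinSet → Model → Model
lift N O M (i , j , K) =
  𝕊 O (i , j , K) ×
  ((i ∉ˢ N ⊎ j ∉ˢ N) ⊎ (Σ FinSet λ K' → IsInter K' K N × M (i , j , K')))

Frame : Set₂
Frame = FinSet → Model → Set₁

IsFrame : Frame → Set₁
IsFrame F = (∀ N M → F N M → M Relation.Unary.⊆ 𝕊 N) × (∀ N → F N (𝕊 N))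

ClosedCopy : Frame → Set₁
ClosedCopy F = ∀ N M f (ℳ : Model) → IsBij f N M → F N ℳ → F M (copy f ℳ)

ClosedMarg : Frame → Set₁
ClosedMarg F = ∀ N M (ℳ : Model) → M ⊆ˢ N → F N ℳ → F M (ℳ ↓ M)

ClosedInter : Frame → Set₁
ClosedInter F = ∀ N (ℳ 𝒜 : Model) → F N ℳ → F N 𝒜 → F N (ℳ ∩ 𝒜)

ClosedLift : Frame → Set₁
ClosedLift F = ∀ N O (ℳ : Model) → N ⊆ˢ O → F N ℳ → F O (lift N O ℳ)

ClosedAscetic : Frame → Set₁
ClosedAscetic F = ∀ N M (ℳ : Model) → N ⊆ˢ M → F N ℳ → F M ℳ

Indep : (ℕ → Set) → (ℕ → Set) → (ℕ → Set) → Model → Set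
Indep I J C Z =
  ∀ i j (L' : FinSet) → I i → J j →
    (∀ x → C x → x ∈ˢ L') →
    (∀ x → x ∈ˢ L' → (I x ⊎ J x ⊎ C x) × x ≢ i × x ≢ j) →
    Z (ci i j L')

SelfAdhesiveAt : Frame → FinSet → Model → FinSet → Set₁
SelfAdhesiveAt F N ℳ L =
  ∀ (f : ℕ → ℕ) (M : FinSet) →
    IsBij f N M →
    IsInter L N M →
    (∀ x → x ∈ˢ L → f x ≡ x) →
    Σ FinSet λ U → Σ Model λ Z →
      IsUnion U N M × F U Z ×
      ((Z ↓ N) ≐ ℳ) × ((Z ↓ M) ≐ copy f ℳ) ×
      Indep (λ x → x ∈ˢ N × x ∉ˢ M) (λ x → x ∈ˢ M × x ∉ˢ N) (λ x → x ∈ˢ L) Z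

Fsa : Frame → Frame
Fsa F N ℳ = F N ℳ × (∀ L → L ⊆ˢ N → SelfAdhesiveAt F N ℳ L)

{-# OPTIONS --safe #-}

-- Every closure property is inherited by transporting amalgams (the models Z witnessing
-- self-adhesivity).  For a copy g(ℳ↓A) of a marginal, pull the gluing bijection f back to N:
-- the map g₀ fixing L₀ = g⁻¹(L) and sending the rest of N to fresh points x + N is a copy of N
-- over L₀, so ℳ has an amalgam Z₀ there; the marginal of Z₀ to A ∪ g₀(A), renamed along the
-- bijection ψ that is g on A and f ∘ g on the fresh points, is an amalgam for g(ℳ↓A).  For
-- ℳ ∩ 𝒜 intersect the two amalgams, and for a lift of ℳ from N to O lift the amalgam of ℳ
-- taken along the restriction of f to N.  Finally, over M ⊇ N an ascetic extension ℳ equals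
-- lift ℳ ∩ 𝕊(N), and 𝕊(N) has the amalgam lift 𝕊(N) ∩ lift 𝕊(f(N)).

module Submission where

open import Defs
open import Level using (0ℓ)
open import Data.Bool using (Bool; true; false; T; _∧_; if_then_else_)
open import Data.Bool.Properties using (T?; T-∧)
open import Data.Nat
open import Data.Nat.Properties
open import Data.Nat.DivMod
open import Data.Product
open import Data.Sum
open import Data.Empty using (⊥-elim)
open import Function.Base using (_∘_)
open import Function.Bundles using (_⇔_; mk⇔; Equivalence)
open import Relation.Nullary using (Dec; yes; no)
open import Relation.Nullary.Decidable using (isYes; toWitness; fromWitness; _×-dec_; _⊎-dec_)
open import Relation.Unary using (Pred; Decidable; _≐_; _∩_; _⊆_)
open import Relation.Unary.Properties using (≐-refl; ≐-sym; ≐-trans)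
open import Relation.Unary.Relation.Binary.Equality using (≐-setoid)
import Relation.Binary.Reasoning.Setoid as SetoidReasoning
open import Relation.Binary.PropositionalEquality hiding ([_])

open Equivalence using (to; from)

variable
  A B C D N M U : FinSet
  x y : ℕ

-- Finite sets of naturals

infixr 5 _∷ᵇ_

_∷ᵇ_ : Bool → ℕ → ℕ
true  ∷ᵇ c = suc (c * 2)
false ∷ᵇ c = c * 2

testBit-∷ᵇ-zero : ∀ b c → testBit (b ∷ᵇ c) 0 ≡ b
testBit-∷ᵇ-zero true  c = cong (_≡ᵇ 1) ([m+kn]%n≡m%n 1 c 2)
testBit-∷ᵇ-zero false c = cong (_≡ᵇ 1) (m*n%n≡0 c 2)

∷ᵇ-/2 : ∀ b c → (b ∷ᵇ c) / 2 ≡ c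
∷ᵇ-/2 true  c = trans (+-distrib-/ 1 (c * 2) (subst (λ r → 1 + r < 2) (sym (m*n%n≡0 c 2)) ≤-refl))
                      (m*n/n≡m c 2)
∷ᵇ-/2 false c = m*n/n≡m c 2

testBit-zero : ∀ x → testBit 0 x ≡ false
testBit-zero zero    = refl
testBit-zero (suc x) = testBit-zero x

fromBits : (ℕ → Bool) → ℕ → FinSet
fromBits p zero    = 0
fromBits p (suc n) = p 0 ∷ᵇ fromBits (p ∘ suc) n

testBit-fromBits : ∀ p n x → testBit (fromBits p n) x ≡ (x <ᵇ n) ∧ p x
testBit-fromBits p zero    x       = testBit-zero x
testBit-fromBits p (suc n) zero    = testBit-∷ᵇ-zero (p 0) _
testBit-fromBits p (suc n) (suc x) =
  trans (cong (λ c → testBit c x) (∷ᵇ-/2 (p 0) _)) (testBit-fromBits (p ∘ suc) n x)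

finSetOf : (P : Pred ℕ 0ℓ) → Decidable P → (n : ℕ) → (∀ x → P x → x < n) →
           Σ FinSet λ S → ∀ x → x ∈ˢ S ⇔ P x
finSetOf P P? n bounded = fromBits (isYes ∘ P?) n , λ x → mk⇔
  (λ x∈S → toWitness {a? = P? x} (proj₂ (to (T-∧ {x <ᵇ n}) (subst T (testBit-fromBits _ n x) x∈S))))
  (λ Px → subst T (sym (testBit-fromBits _ n x))
                  (from (T-∧ {x <ᵇ n}) (<⇒<ᵇ (bounded x Px) , fromWitness Px)))

∈ˢ⇒< : x ∈ˢ N → x < N
∈ˢ⇒< {zero}  {suc N} _   = z<s
∈ˢ⇒< {suc x} {N}     x∈N = begin-strict
  suc x          <⟨ m<m*n (suc x) 2 (s≤s (s≤s z≤n)) ⟩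
  suc x * 2      ≤⟨ *-monoˡ-≤ 2 (∈ˢ⇒< {x} {N / 2} x∈N) ⟩
  N / 2 * 2      ≤⟨ m/n*n≤m N 2 ⟩
  N              ∎
  where open ≤-Reasoning

_∈ˢ?_ : ∀ x N → Dec (x ∈ˢ N)
x ∈ˢ? N = T? (testBit N x)

%2-testBit : ∀ a → a % 2 ≡ (if testBit a 0 then 1 else 0)
%2-testBit a with a % 2 | m%n<n a 2
... | 0 | _ = refl
... | 1 | _ = refl
... | suc (suc _) | s≤s (s≤s ())

testBit-injective : ∀ {a b} → (∀ x → testBit a x ≡ testBit b x) → a ≡ b
testBit-injective {a} {b} = go (a + b) (m≤m+n a b) (m≤n+m b a)
  where
  half≤ : ∀ {a n} → a ≤ suc n → a / 2 ≤ n
  half≤ {zero}  _  = z≤n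
  half≤ {suc a} le = ≤-pred (<-≤-trans (m/n<m (suc a) 2 (s≤s (s≤s z≤n))) le)
  go : ∀ n {a b} → a ≤ n → b ≤ n → (∀ x → testBit a x ≡ testBit b x) → a ≡ b
  go zero    z≤n z≤n _    = refl
  go (suc n) {a} {b} a≤ b≤ same = begin
    a                   ≡⟨ m≡m%n+[m/n]*n a 2 ⟩
    a % 2 + a / 2 * 2   ≡⟨ cong₂ (λ r q → r + q * 2) low high ⟩
    b % 2 + b / 2 * 2   ≡⟨ m≡m%n+[m/n]*n b 2 ⟨
    b                   ∎
    where
    open ≡-Reasoning
    low : a % 2 ≡ b % 2
    low = trans (%2-testBit a) (trans (cong (if_then 1 else 0) (same 0)) (sym (%2-testBit b)))
    high : a / 2 ≡ b / 2
    high = go n (half≤ a≤) (half≤ b≤) (same ∘ suc)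

⊆ˢ-antisym : A ⊆ˢ B → B ⊆ˢ A → A ≡ B
⊆ˢ-antisym {A} {B} A⊆B B⊆A = testBit-injective λ x → T-injective (A⊆B x) (B⊆A x)
  where
  T-injective : ∀ {b c} → (T b → T c) → (T c → T b) → b ≡ c
  T-injective {false} {false} _ _ = refl
  T-injective {false} {true}  _ f = ⊥-elim (f _)
  T-injective {true}  {false} f _ = ⊥-elim (f _)
  T-injective {true}  {true}  _ _ = refl

unionWithSpec : ∀ A B → Σ FinSet λ S → IsUnion S A B
unionWithSpec A B = finSetOf _ (λ x → x ∈ˢ? A ⊎-dec x ∈ˢ? B) (A + B) bounded
  where
  bounded : ∀ x → x ∈ˢ A ⊎ x ∈ˢ B → x < A + B
  bounded x (inj₁ x∈A) = <-≤-trans (∈ˢ⇒< x∈A) (m≤m+n A B)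
  bounded x (inj₂ x∈B) = <-≤-trans (∈ˢ⇒< x∈B) (m≤n+m B A)

_∪ˢ_ : FinSet → FinSet → FinSet
A ∪ˢ B = proj₁ (unionWithSpec A B)

∪ˢ-isUnion : ∀ A B → IsUnion (A ∪ˢ B) A B
∪ˢ-isUnion A B = proj₂ (unionWithSpec A B)

interWithSpec : ∀ A B → Σ FinSet λ S → IsInter S A B
interWithSpec A B = finSetOf _ (λ x → x ∈ˢ? A ×-dec x ∈ˢ? B) A (λ _ → ∈ˢ⇒< ∘ proj₁)

_∩ˢ_ : FinSet → FinSet → FinSet
A ∩ˢ B = proj₁ (interWithSpec A B)

∩ˢ-isInter : ∀ A B → IsInter (A ∩ˢ B) A B
∩ˢ-isInter A B = proj₂ (interWithSpec A B)

preimageWithSpec : ∀ (f : ℕ → ℕ) N K → Σ FinSet λ S → ∀ x → x ∈ˢ S ⇔ (x ∈ˢ N × f x ∈ˢ K)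
preimageWithSpec f N K = finSetOf _ (λ x → x ∈ˢ? N ×-dec f x ∈ˢ? K) N (λ _ → ∈ˢ⇒< ∘ proj₁)

preimage : (ℕ → ℕ) → FinSet → FinSet → FinSet
preimage f N K = proj₁ (preimageWithSpec f N K)

∈-preimage : ∀ f N K x → x ∈ˢ preimage f N K ⇔ (x ∈ˢ N × f x ∈ˢ K)
∈-preimage f N K = proj₂ (preimageWithSpec f N K)

imageWithSpec : (f : ℕ → ℕ) (K : FinSet) →
                Σ FinSet λ S → ∀ y → y ∈ˢ S ⇔ (∃[ k ] (k < K × k ∈ˢ K × f k ≡ y))
imageWithSpec f K = finSetOf _ (λ y → anyUpTo? (λ k → k ∈ˢ? K ×-dec f k ≟ y) K) (bound K) bounded
  where
  bound : ℕ → ℕ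
  bound zero    = 0
  bound (suc n) = suc (f n) + bound n
  bounded : ∀ y → ∃[ k ] (k < K × k ∈ˢ K × f k ≡ y) → y < bound K
  bounded y (k , k<K , _ , refl) = below K k<K
    where
    below : ∀ n → k < n → f k < bound n
    below (suc n) k<1+n with m<1+n⇒m<n∨m≡n k<1+n
    ... | inj₁ k<n  = <-≤-trans (below n k<n) (m≤n+m (bound n) (suc (f n)))
    ... | inj₂ refl = m≤m+n (suc (f k)) (bound n)

image : (ℕ → ℕ) → FinSet → FinSet
image f K = proj₁ (imageWithSpec f K)

image-isImage : ∀ f K → IsImage f K (image f K)
image-isImage f K y = mk⇔
  (λ y∈ → let (k , _ , k∈K , fk≡y) = to (proj₂ (imageWithSpec f K) y) y∈ in k , k∈K , fk≡y)
  (λ { (k , k∈K , fk≡y) → from (proj₂ (imageWithSpec f K) y) (k , ∈ˢ⇒< k∈K , k∈K , fk≡y) })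

union-⊆ˡ : IsUnion U A B → A ⊆ˢ U
union-⊆ˡ U=A∪B x x∈A = from (U=A∪B x) (inj₁ x∈A)

union-⊆ʳ : IsUnion U A B → B ⊆ˢ U
union-⊆ʳ U=A∪B x x∈B = from (U=A∪B x) (inj₂ x∈B)

union-unique : ∀ {U U′} → IsUnion U A B → IsUnion U′ A B → U ≡ U′
union-unique U=A∪B U′=A∪B =
  ⊆ˢ-antisym (λ x → from (U′=A∪B x) ∘ to (U=A∪B x)) (λ x → from (U=A∪B x) ∘ to (U′=A∪B x))

union-least : IsUnion U A B → A ⊆ˢ C → B ⊆ˢ C → U ⊆ˢ C
union-least U=A∪B A⊆C B⊆C x x∈U = [ A⊆C x , B⊆C x ] (to (U=A∪B x) x∈U)

inter-⊆ˡ : IsInter C A B → C ⊆ˢ A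
inter-⊆ˡ C=A∩B x = proj₁ ∘ to (C=A∩B x)

inter-⊆ʳ : IsInter C A B → C ⊆ˢ B
inter-⊆ʳ C=A∩B x = proj₂ ∘ to (C=A∩B x)

inter-intro : IsInter C A B → ∀ x → x ∈ˢ A → x ∈ˢ B → x ∈ˢ C
inter-intro C=A∩B x x∈A x∈B = from (C=A∩B x) (x∈A , x∈B)

inter-self : A ⊆ˢ B → IsInter A A B
inter-self A⊆B x = mk⇔ (λ x∈A → x∈A , A⊆B x x∈A) proj₁

-- Maps, bijections and images

variable
  f g h : ℕ → ℕ

InjectiveOn : (ℕ → ℕ) → FinSet → Set
InjectiveOn f N = ∀ x y → x ∈ˢ N → y ∈ˢ N → f x ≡ f y → x ≡ y

bij-∈ : IsBij f N M → ∀ x → x ∈ˢ N → f x ∈ˢ M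
bij-∈ (maps , _ , _) = maps

bij-injective : IsBij f N M → InjectiveOn f N
bij-injective (_ , injective , _) = injective

bij-surjective : IsBij f N M → ∀ y → y ∈ˢ M → ∃[ x ] (x ∈ˢ N × f x ≡ y)
bij-surjective (_ , _ , surjective) = surjective

id-isBij : IsBij (λ x → x) N N
id-isBij = (λ _ x∈N → x∈N) , (λ _ _ _ _ x≡y → x≡y) , (λ y y∈N → y , y∈N , refl)

bij⇒isImage : IsBij f N M → IsImage f N M
bij⇒isImage fb y = mk⇔ (bij-surjective fb y) (λ { (x , x∈N , refl) → bij-∈ fb x x∈N })

image-∈ : ∀ {K K′} → IsImage f K K′ → ∀ x → x ∈ˢ K → f x ∈ˢ K′
image-∈ {f} img x x∈K = from (img (f x)) (x , x∈K , refl)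

image-∈⁻ : InjectiveOn f A → C ⊆ˢ A → IsImage f C D → ∀ x → x ∈ˢ A → f x ∈ˢ D → x ∈ˢ C
image-∈⁻ {f} {C = C} inj C⊆A img x x∈A fx∈D with to (img (f x)) fx∈D
... | c , c∈C , fc≡fx = subst (_∈ˢ C) (inj c x (C⊆A c c∈C) x∈A fc≡fx) c∈C

image-mono : ∀ {K K′} → IsImage f K K′ → K ⊆ˢ C → IsImage f C D → K′ ⊆ˢ D
image-mono img K⊆C imgC y y∈K′ with to (img y) y∈K′
... | k , k∈K , refl = image-∈ imgC k (K⊆C k k∈K)

image-unique : ∀ {K K₁ K₂} → IsImage f K K₁ → IsImage f K K₂ → K₁ ≡ K₂
image-unique img₁ img₂ = ⊆ˢ-antisym (λ y → from (img₂ y) ∘ to (img₁ y)) (λ y → from (img₁ y) ∘ to (img₂ y))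

image-injective : ∀ {K₁ K₂ K} → InjectiveOn f N → K₁ ⊆ˢ N → K₂ ⊆ˢ N →
                  IsImage f K₁ K → IsImage f K₂ K → K₁ ≡ K₂
image-injective inj K₁⊆N K₂⊆N img₁ img₂ =
  ⊆ˢ-antisym (λ x x∈K₁ → image-∈⁻ inj K₂⊆N img₂ x (K₁⊆N x x∈K₁) (image-∈ img₁ x x∈K₁))
             (λ x x∈K₂ → image-∈⁻ inj K₁⊆N img₁ x (K₂⊆N x x∈K₂) (image-∈ img₂ x x∈K₂))

image-id : ∀ K → IsImage (λ x → x) K K
image-id K y = mk⇔ (λ y∈K → y , y∈K , refl) (λ { (k , k∈K , refl) → k∈K })

image-cong : ∀ {K K′} → K ⊆ˢ A → (∀ x → x ∈ˢ A → f x ≡ g x) → IsImage f K K′ → IsImage g K K′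
image-cong K⊆A f≗g img y = mk⇔
  (λ y∈K′ → let (k , k∈K , fk≡y) = to (img y) y∈K′ in k , k∈K , trans (sym (f≗g k (K⊆A k k∈K))) fk≡y)
  (λ { (k , k∈K , refl) → subst (_∈ˢ _) (f≗g k (K⊆A k k∈K)) (image-∈ img k k∈K) })

image-∘ : ∀ {K K₁ K₂} → IsImage g K K₁ → IsImage h K₁ K₂ → IsImage (h ∘ g) K K₂
image-∘ {h = h} img₁ img₂ y = mk⇔
  (λ y∈K₂ → let (k₁ , k₁∈K₁ , hk₁≡y) = to (img₂ y) y∈K₂
                (k , k∈K , gk≡k₁) = to (img₁ k₁) k₁∈K₁
            in k , k∈K , trans (cong h gk≡k₁) hk₁≡y)
  (λ { (k , k∈K , refl) → image-∈ img₂ _ (image-∈ img₁ k k∈K) })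

image-∘⁻ : ∀ {K K₁ K₂} → IsImage g K K₁ → IsImage (h ∘ g) K K₂ → IsImage h K₁ K₂
image-∘⁻ {h = h} img₁ img₂ y = mk⇔
  (λ y∈K₂ → let (k , k∈K , hgk≡y) = to (img₂ y) y∈K₂ in _ , image-∈ img₁ k k∈K , hgk≡y)
  (λ { (k₁ , k₁∈K₁ , refl) → let (k , k∈K , gk≡k₁) = to (img₁ k₁) k₁∈K₁
                             in subst (λ z → h z ∈ˢ _) gk≡k₁ (image-∈ img₂ k k∈K) })

injectiveOn-⊆ : InjectiveOn f A → B ⊆ˢ A → InjectiveOn f B
injectiveOn-⊆ inj B⊆A x y x∈B y∈B = inj x y (B⊆A x x∈B) (B⊆A y y∈B)

image-inter : ∀ {K K₁ N₁ K₀ K₀′} → InjectiveOn f A → K ⊆ˢ A → N ⊆ˢ A → IsImage f K K₁ → IsImage f N N₁ →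
              IsInter K₀ K N → IsInter K₀′ K₁ N₁ → IsImage f K₀ K₀′
image-inter {f = f} inj K⊆A N⊆A imgK imgN K₀=K∩N K₀′=K₁∩N₁ y = mk⇔
  (λ y∈K₀′ → let (y∈K₁ , y∈N₁) = to (K₀′=K₁∩N₁ y) y∈K₀′
                 (k , k∈K , fk≡y) = to (imgK y) y∈K₁
                 k∈N = image-∈⁻ inj N⊆A imgN k (K⊆A k k∈K) (subst (_∈ˢ _) (sym fk≡y) y∈N₁)
             in k , inter-intro K₀=K∩N k k∈K k∈N , fk≡y)
  (λ { (k , k∈K₀ , refl) → let (k∈K , k∈N) = to (K₀=K∩N k) k∈K₀
                           in inter-intro K₀′=K₁∩N₁ (f k) (image-∈ imgK k k∈K) (image-∈ imgN k k∈N) })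

preimage-isImage : ∀ {K} → IsBij f N M → K ⊆ˢ M → IsImage f (preimage f N K) K
preimage-isImage {f} {N} {K = K} fb K⊆M y = mk⇔
  (λ y∈K → let (x , x∈N , fx≡y) = bij-surjective fb y (K⊆M y y∈K)
           in x , from (∈-preimage f N K x) (x∈N , subst (_∈ˢ K) (sym fx≡y) y∈K) , fx≡y)
  (λ { (x , x∈pre , refl) → proj₂ (to (∈-preimage f N K x) x∈pre) })

preimage-⊆ : ∀ (f : ℕ → ℕ) K → preimage f N K ⊆ˢ N
preimage-⊆ {N} f K x = proj₁ ∘ to (∈-preimage f N K x)

-- Unordered pairs and statements

variable
  a b i j : ℕ
  K : FinSet

-- {a , b} = {x , y}, the shape of the index condition in copy
SamePair : ℕ → ℕ → ℕ → ℕ → Set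
SamePair a b x y = (a ≡ x × b ≡ y) ⊎ (a ≡ y × b ≡ x)

samePair-⊓⊔ : ∀ x y → SamePair (x ⊓ y) (x ⊔ y) x y
samePair-⊓⊔ x y with ≤-total x y
... | inj₁ x≤y = inj₁ (m≤n⇒m⊓n≡m x≤y , m≤n⇒m⊔n≡n x≤y)
... | inj₂ y≤x = inj₂ (m≥n⇒m⊓n≡n y≤x , m≥n⇒m⊔n≡m y≤x)

samePair-sym : SamePair a b x y → SamePair x y a b
samePair-sym (inj₁ (refl , refl)) = inj₁ (refl , refl)
samePair-sym (inj₂ (refl , refl)) = inj₂ (refl , refl)

samePair-trans : ∀ {c d} → SamePair a b x y → SamePair x y c d → SamePair a b c d
samePair-trans (inj₁ (refl , refl)) q                    = q
samePair-trans (inj₂ (refl , refl)) (inj₁ (refl , refl)) = inj₂ (refl , refl)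
samePair-trans (inj₂ (refl , refl)) (inj₂ (refl , refl)) = inj₁ (refl , refl)

samePair-map : (f : ℕ → ℕ) → SamePair a b x y → SamePair (f a) (f b) (f x) (f y)
samePair-map f (inj₁ (refl , refl)) = inj₁ (refl , refl)
samePair-map f (inj₂ (refl , refl)) = inj₂ (refl , refl)

samePair-injective : InjectiveOn f N → a ∈ˢ N → b ∈ˢ N → x ∈ˢ N → y ∈ˢ N →
                     SamePair (f a) (f b) (f x) (f y) → SamePair a b x y
samePair-injective inj a∈N b∈N x∈N y∈N (inj₁ (p , q)) = inj₁ (inj _ _ a∈N x∈N p , inj _ _ b∈N y∈N q)
samePair-injective inj a∈N b∈N x∈N y∈N (inj₂ (p , q)) = inj₂ (inj _ _ a∈N y∈N p , inj _ _ b∈N x∈N q)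

samePair-all : (P : ℕ → Set) → SamePair a b x y → P x → P y → P a × P b
samePair-all P (inj₁ (refl , refl)) px py = px , py
samePair-all P (inj₂ (refl , refl)) px py = py , px

samePair-any : (P : ℕ → Set) → SamePair a b x y → P x ⊎ P y → P a ⊎ P b
samePair-any P (inj₁ (refl , refl)) = [ inj₁ , inj₂ ]
samePair-any P (inj₂ (refl , refl)) = [ inj₂ , inj₁ ]

samePair-< : a < b → x < y → SamePair a b x y → a ≡ x × b ≡ y
samePair-< a<b x<y (inj₁ eqs)          = eqs
samePair-< a<b x<y (inj₂ (refl , refl)) = ⊥-elim (<-asym a<b x<y)

⊓<⊔ : x ≢ y → x ⊓ y < x ⊔ y
⊓<⊔ {x} {y} x≢y with ≤-total x y
... | inj₁ x≤y = subst₂ _<_ (sym (m≤n⇒m⊓n≡m x≤y)) (sym (m≤n⇒m⊔n≡n x≤y)) (≤∧≢⇒< x≤y x≢y)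
... | inj₂ y≤x = subst₂ _<_ (sym (m≥n⇒m⊓n≡n y≤x)) (sym (m≥n⇒m⊔n≡m y≤x)) (≤∧≢⇒< y≤x (x≢y ∘ sym))

samePair-≢ : a < b → SamePair a b x y → x ≢ y
samePair-≢ a<b (inj₁ (refl , refl)) refl = <-irrefl refl a<b
samePair-≢ a<b (inj₂ (refl , refl)) refl = <-irrefl refl a<b

ci-≡ : a < b → SamePair a b x y → ci x y K ≡ (a , b , K)
ci-≡ {a} {b} {x} {y} a<b p with samePair-trans (samePair-⊓⊔ x y) (samePair-sym p)
... | inj₁ (x⊓y≡a , x⊔y≡b) = cong₂ (λ u v → u , v , _) x⊓y≡a x⊔y≡b
... | inj₂ (x⊓y≡b , x⊔y≡a) = ⊥-elim (<⇒≱ a<b (subst₂ _≤_ x⊓y≡b x⊔y≡a (m⊓n≤m⊔n x y)))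

samePair-ci : ∀ x y → SamePair (f x ⊓ f y) (f x ⊔ f y) (f (x ⊓ y)) (f (x ⊔ y))
samePair-ci {f} x y =
  samePair-trans (samePair-⊓⊔ (f x) (f y)) (samePair-sym (samePair-map f (samePair-⊓⊔ x y)))

𝕊-ci : i ≢ j → i ∈ˢ N → j ∈ˢ N → K ⊆ˢ N → i ∉ˢ K → j ∉ˢ K → 𝕊 N (ci i j K)
𝕊-ci {i} {j} {N} {K} i≢j i∈N j∈N K⊆N i∉K j∉K =
  ⊓<⊔ i≢j , ⊓⊔∈N .proj₁ , ⊓⊔∈N .proj₂ , K⊆N , ⊓⊔∉K .proj₁ , ⊓⊔∉K .proj₂
  where
  ⊓⊔∈N = samePair-all (_∈ˢ N) (samePair-⊓⊔ i j) i∈N j∈N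
  ⊓⊔∉K = samePair-all (_∉ˢ K) (samePair-⊓⊔ i j) i∉K j∉K

𝕊-mono : A ⊆ˢ B → 𝕊 A ⊆ 𝕊 B
𝕊-mono A⊆B {i , j , K} (i<j , i∈A , j∈A , K⊆A , i∉K , j∉K) =
  i<j , A⊆B i i∈A , A⊆B j j∈A , (λ x → A⊆B x ∘ K⊆A x) , i∉K , j∉K

-- Copies

variable
  X Y Z : Model

copy-ci : X (ci i j K) → f i ≢ f j → ∀ {K′} → IsImage f K K′ → copy f X (ci (f i) (f j) K′)
copy-ci {i = i} {j} {K = K} x fi≢fj img = i ⊓ j , i ⊔ j , K , x , ⊓<⊔ fi≢fj , samePair-ci i j , img

copy-intro : X (i , j , K) → f i ≢ f j → ∀ {K′} → IsImage f K K′ → copy f X (ci (f i) (f j) K′)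
copy-intro {i = i} {j} {K = K} {f = f} x fi≢fj img = i , j , K , x , ⊓<⊔ fi≢fj , samePair-⊓⊔ (f i) (f j) , img

copy-mono : X ⊆ Y → copy f X ⊆ copy f Y
copy-mono X⊆Y (i , j , K , x , rest) = i , j , K , X⊆Y x , rest

copy-cong : X ≐ Y → copy f X ≐ copy f Y
copy-cong (X⊆Y , Y⊆X) = copy-mono X⊆Y , copy-mono Y⊆X

copy-⊆𝕊 : X ⊆ 𝕊 C → C ⊆ˢ A → InjectiveOn f A → IsImage f C D → copy f X ⊆ 𝕊 D
copy-⊆𝕊 {C = C} {A = A} {f = f} {D = D} X⊆𝕊C C⊆A inj img (i , j , K , x , a<b , p , imgK) with X⊆𝕊C x
... | _ , i∈C , j∈C , K⊆C , i∉K , j∉K =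
  a<b , ab∈D .proj₁ , ab∈D .proj₂ , image-mono imgK K⊆C img , ab∉K′ .proj₁ , ab∉K′ .proj₂
  where
  ab∈D = samePair-all (_∈ˢ D) p (image-∈ img i i∈C) (image-∈ img j j∈C)
  K⊆A : K ⊆ˢ A
  K⊆A k = C⊆A k ∘ K⊆C k
  fk∉K′ : ∀ k → k ∈ˢ C → k ∉ˢ K → f k ∉ˢ _
  fk∉K′ k k∈C k∉K = k∉K ∘ image-∈⁻ inj K⊆A imgK k (C⊆A k k∈C)
  ab∉K′ = samePair-all (_∉ˢ _) p (fk∉K′ i i∈C i∉K) (fk∉K′ j j∈C j∉K)

copy-preimage : ∀ {K′} → X ⊆ 𝕊 N → InjectiveOn f N → 𝕊 N (i , j , K) →
                SamePair a b (f i) (f j) → IsImage f K K′ → copy f X (a , b , K′) → X (i , j , K)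
copy-preimage {X = X} {N = N} X⊆𝕊N inj (i<j , i∈N , j∈N , K⊆N , _) p img
              (i′ , j′ , K₀ , x , _ , p′ , img₀) with X⊆𝕊N x
... | i′<j′ , i′∈N , j′∈N , K₀⊆N , _ with samePair-< i′<j′ i<j
      (samePair-injective inj i′∈N j′∈N i∈N j∈N (samePair-trans (samePair-sym p′) p))
... | refl , refl = subst (λ K → X (_ , _ , K)) (image-injective inj K₀⊆N K⊆N img₀ img) x

copy-∩ : X ⊆ 𝕊 N → Y ⊆ 𝕊 N → InjectiveOn f N → copy f (X ∩ Y) ≐ (copy f X ∩ copy f Y)
copy-∩ X⊆𝕊N Y⊆𝕊N inj =
  (λ c → copy-mono proj₁ c , copy-mono proj₂ c) ,
  λ { (c@(i , j , K , x , a<b , p , img) , c′) →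
        i , j , K , (x , copy-preimage Y⊆𝕊N inj (X⊆𝕊N x) p img c′) , a<b , p , img }

copy-↓ : X ⊆ 𝕊 A → C ⊆ˢ A → InjectiveOn f A → IsImage f C D → copy f (X ↓ C) ≐ (copy f X ↓ D)
copy-↓ {X = X} {A = A} {C = C} {f = f} {D = D} X⊆𝕊A C⊆A inj img =
  (λ c → copy-mono proj₁ c , copy-⊆𝕊 proj₂ C⊆A inj img c) , reflect
  where
  reflect : (copy f X ↓ D) ⊆ copy f (X ↓ C)
  reflect ((i , j , K , x , a<b , p , imgK) , (_ , a∈D , b∈D , K′⊆D , _)) with X⊆𝕊A x
  ... | i<j , i∈A , j∈A , K⊆A , i∉K , j∉K =
    i , j , K , (x , i<j , i∈C , j∈C , K⊆C , i∉K , j∉K) , a<b , p , imgK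
    where
    fij∈D = samePair-all (_∈ˢ D) (samePair-sym p) a∈D b∈D
    i∈C = image-∈⁻ inj C⊆A img i i∈A (fij∈D .proj₁)
    j∈C = image-∈⁻ inj C⊆A img j j∈A (fij∈D .proj₂)
    K⊆C : K ⊆ˢ C
    K⊆C k k∈K = image-∈⁻ inj C⊆A img k (K⊆A k k∈K) (K′⊆D (f k) (image-∈ imgK k k∈K))

copy-𝕊 : IsBij f N M → copy f (𝕊 N) ≐ 𝕊 M
copy-𝕊 {f = f} {N = N} {M = M} fb =
  copy-⊆𝕊 (λ s → s) (λ _ x∈N → x∈N) (bij-injective fb) (bij⇒isImage fb) , reflect
  where
  reflect : 𝕊 M ⊆ copy f (𝕊 N)
  reflect {a , b , K′} (a<b , a∈M , b∈M , K′⊆M , a∉K′ , b∉K′)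
    with bij-surjective fb a a∈M | bij-surjective fb b b∈M
  ... | i , i∈N , refl | j , j∈N , refl =
    subst (copy f (𝕊 N)) (ci-≡ a<b (samePair-map f (inj₁ (refl , refl))))
          (copy-ci (𝕊-ci i≢j i∈N j∈N (preimage-⊆ f K′) (a∉K′ ∘ proj₂ ∘ pre i) (b∉K′ ∘ proj₂ ∘ pre j))
                   (samePair-≢ a<b (inj₁ (refl , refl))) (preimage-isImage fb K′⊆M))
    where
    pre : ∀ x → x ∈ˢ preimage f N K′ → x ∈ˢ N × f x ∈ˢ K′
    pre x = to (∈-preimage f N K′ x)
    i≢j : i ≢ j
    i≢j refl = <-irrefl refl a<b

copy-id : X ⊆ 𝕊 N → copy (λ x → x) X ≐ X
copy-id {X = X} X⊆𝕊N = reflect , extend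
  where
  extend : X ⊆ copy (λ x → x) X
  extend {i , j , K} x = i , j , K , x , proj₁ (X⊆𝕊N x) , inj₁ (refl , refl) , image-id K
  reflect : copy (λ x → x) X ⊆ X
  reflect (i , j , K , x , a<b , p , img) with samePair-< a<b (proj₁ (X⊆𝕊N x)) p
  ... | refl , refl = subst (λ K′ → X (_ , _ , K′)) (image-unique (image-id K) img) x

copy-∘ : copy (h ∘ g) X ≐ copy h (copy g X)
copy-∘ {h = h} {g = g} {X = X} = split , merge
  where
  split : copy (h ∘ g) X ⊆ copy h (copy g X)
  split (i , j , K , x , a<b , p , img) =
    g i ⊓ g j , g i ⊔ g j , image g K ,
    copy-intro x (λ gi≡gj → samePair-≢ a<b p (cong h gi≡gj)) (image-isImage g K) ,
    a<b , samePair-trans p (samePair-sym (samePair-map h (samePair-⊓⊔ (g i) (g j)))) ,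
    image-∘⁻ (image-isImage g K) img
  merge : copy h (copy g X) ⊆ copy (h ∘ g) X
  merge (_ , _ , _ , (i , j , K , x , _ , p′ , img′) , a<b , p , img) =
    i , j , K , x , a<b , samePair-trans p (samePair-map h p′) , image-∘ img′ img

copy-cong-on : X ⊆ 𝕊 A → (∀ x → x ∈ˢ A → f x ≡ g x) → copy f X ≐ copy g X
copy-cong-on X⊆𝕊A f≗g = transfer X⊆𝕊A f≗g , transfer X⊆𝕊A (λ x x∈A → sym (f≗g x x∈A))
  where
  transfer : X ⊆ 𝕊 A → (∀ x → x ∈ˢ A → f x ≡ g x) → copy f X ⊆ copy g X
  transfer X⊆𝕊A f≗g (i , j , K , x , a<b , p , img) with X⊆𝕊A x
  ... | _ , i∈A , j∈A , K⊆A , _ =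
    i , j , K , x , a<b , subst₂ (SamePair _ _) (f≗g i i∈A) (f≗g j j∈A) p , image-cong K⊆A f≗g img

-- Marginals and lifts

module ≐-Reasoning = SetoidReasoning (≐-setoid Stmt 0ℓ)

∩-cong : ∀ {X′ Y′ : Model} → X ≐ X′ → Y ≐ Y′ → (X ∩ Y) ≐ (X′ ∩ Y′)
∩-cong (X⊆X′ , X′⊆X) (Y⊆Y′ , Y′⊆Y) = (λ (x , y) → X⊆X′ x , Y⊆Y′ y) , (λ (x , y) → X′⊆X x , Y′⊆Y y)

∩-comm : (X ∩ Y) ≐ (Y ∩ X)
∩-comm = (λ (x , y) → y , x) , (λ (y , x) → x , y)

↓-cong : X ≐ Y → (X ↓ N) ≐ (Y ↓ N)
↓-cong (X⊆Y , Y⊆X) = (λ (x , s) → X⊆Y x , s) , (λ (y , s) → Y⊆X y , s)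

↓-↓ : B ⊆ˢ A → ((X ↓ A) ↓ B) ≐ (X ↓ B)
↓-↓ B⊆A = (λ ((x , _) , s) → x , s) , (λ (x , s) → (x , 𝕊-mono B⊆A s) , s)

↓-self : X ⊆ 𝕊 N → (X ↓ N) ≐ X
↓-self X⊆𝕊N = proj₁ , (λ x → x , X⊆𝕊N x)

↓-∩ : ((X ∩ Y) ↓ N) ≐ ((X ↓ N) ∩ (Y ↓ N))
↓-∩ = (λ ((x , y) , s) → (x , s) , (y , s)) , (λ ((x , s) , (y , _)) → (x , y) , s)

lift-mono : ∀ {O} → X ⊆ Y → lift N O X ⊆ lift N O Y
lift-mono X⊆Y (s , inj₁ outside)          = s , inj₁ outside
lift-mono X⊆Y (s , inj₂ (K′ , K′=K∩N , x)) = s , inj₂ (K′ , K′=K∩N , X⊆Y {_ , _ , K′} x)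

lift-cong : ∀ {O} → X ≐ Y → lift N O X ≐ lift N O Y
lift-cong {X = X} {Y = Y} (X⊆Y , Y⊆X) = lift-mono {X = X} {Y = Y} X⊆Y , lift-mono {X = Y} {Y = X} Y⊆X

inter-widen : ∀ {O U₀ K′} → K ⊆ˢ O → IsInter N O U₀ → IsInter K′ K N → IsInter K′ K U₀
inter-widen K⊆O N=O∩U₀ K′=K∩N x = mk⇔
  (λ x∈K′ → let (x∈K , x∈N) = to (K′=K∩N x) x∈K′ in x∈K , inter-⊆ʳ N=O∩U₀ x x∈N)
  (λ (x∈K , x∈U₀) → from (K′=K∩N x) (x∈K , inter-intro N=O∩U₀ x (K⊆O x x∈K) x∈U₀))

inter-narrow : ∀ {O U₀ K′} → K ⊆ˢ O → IsInter N O U₀ → IsInter K′ K U₀ → IsInter K′ K N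
inter-narrow K⊆O N=O∩U₀ K′=K∩U₀ x = mk⇔
  (λ x∈K′ → let (x∈K , x∈U₀) = to (K′=K∩U₀ x) x∈K′ in x∈K , inter-intro N=O∩U₀ x (K⊆O x x∈K) x∈U₀)
  (λ (x∈K , x∈N) → from (K′=K∩U₀ x) (x∈K , inter-⊆ʳ N=O∩U₀ x x∈N))

lift-↓ : ∀ {O U₀} → O ⊆ˢ U → IsInter N O U₀ → (lift U₀ U Z ↓ O) ≐ lift N O (Z ↓ N)
lift-↓ {U = U} {N = N} {Z = Z} {O} {U₀} O⊆U N=O∩U₀ = restrict , extend
  where
  N⊆U₀ = inter-⊆ʳ N=O∩U₀
  restrict : (lift U₀ U Z ↓ O) ⊆ lift N O (Z ↓ N)
  restrict {i , j , K} ((_ , inj₁ (inj₁ i∉U₀)) , s) = s , inj₁ (inj₁ (i∉U₀ ∘ N⊆U₀ i))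
  restrict {i , j , K} ((_ , inj₁ (inj₂ j∉U₀)) , s) = s , inj₁ (inj₂ (j∉U₀ ∘ N⊆U₀ j))
  restrict {i , j , K} ((_ , inj₂ (K′ , K′=K∩U₀ , z)) , s@(i<j , _ , _ , K⊆O , i∉K , j∉K))
    with i ∈ˢ? N | j ∈ˢ? N
  ... | no i∉N | _      = s , inj₁ (inj₁ i∉N)
  ... | yes _  | no j∉N = s , inj₁ (inj₂ j∉N)
  ... | yes i∈N | yes j∈N =
    s , inj₂ (K′ , K′=K∩N , z , i<j , i∈N , j∈N , inter-⊆ʳ K′=K∩N , i∉K ∘ inter-⊆ˡ K′=K∩N i ,
              j∉K ∘ inter-⊆ˡ K′=K∩N j)
    where K′=K∩N = inter-narrow K⊆O N=O∩U₀ K′=K∩U₀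
  extend : lift N O (Z ↓ N) ⊆ (lift U₀ U Z ↓ O)
  extend {i , j , K} (s@(_ , i∈O , j∈O , K⊆O , _) , inj₁ (inj₁ i∉N)) =
    (𝕊-mono O⊆U s , inj₁ (inj₁ (i∉N ∘ inter-intro N=O∩U₀ i i∈O))) , s
  extend {i , j , K} (s@(_ , i∈O , j∈O , K⊆O , _) , inj₁ (inj₂ j∉N)) =
    (𝕊-mono O⊆U s , inj₁ (inj₂ (j∉N ∘ inter-intro N=O∩U₀ j j∈O))) , s
  extend {i , j , K} (s@(_ , _ , _ , K⊆O , _) , inj₂ (K′ , K′=K∩N , z , _)) =
    (𝕊-mono O⊆U s , inj₂ (K′ , inter-widen K⊆O N=O∩U₀ K′=K∩N , z)) , s

lift-↓-self : X ⊆ 𝕊 N → N ⊆ˢ U → (lift N U X ↓ N) ≐ X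
lift-↓-self {X = X} {N = N} {U = U} X⊆𝕊N N⊆U = restrict , extend
  where
  restrict : (lift N U X ↓ N) ⊆ X
  restrict ((_ , inj₁ (inj₁ i∉N)) , (_ , i∈N , _)) = ⊥-elim (i∉N i∈N)
  restrict ((_ , inj₁ (inj₂ j∉N)) , (_ , _ , j∈N , _)) = ⊥-elim (j∉N j∈N)
  restrict ((_ , inj₂ (K′ , K′=K∩N , x)) , (_ , _ , _ , K⊆N , _)) =
    subst (λ K → X (_ , _ , K)) (⊆ˢ-antisym (inter-⊆ˡ K′=K∩N) (λ k k∈K → from (K′=K∩N k) (k∈K , K⊆N k k∈K))) x
  extend : X ⊆ (lift N U X ↓ N)
  extend x with X⊆𝕊N x
  ... | s@(_ , _ , _ , K⊆N , _) = (𝕊-mono N⊆U s , inj₂ (_ , inter-self K⊆N , x)) , s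

𝕊-⊆-lift : ∀ {O N′} → N ⊆ˢ U → (∀ x → x ∈ˢ N → x ∈ˢ O → x ∈ˢ N′) → 𝕊 N ⊆ lift O U (𝕊 N′)
𝕊-⊆-lift {N = N} {U = U} {O} N⊆U N∩O⊆N′ {i , j , K} s@(i<j , i∈N , j∈N , K⊆N , i∉K , j∉K)
  with i ∈ˢ? O | j ∈ˢ? O
... | no i∉O | _      = 𝕊-mono N⊆U s , inj₁ (inj₁ i∉O)
... | yes _  | no j∉O = 𝕊-mono N⊆U s , inj₁ (inj₂ j∉O)
... | yes i∈O | yes j∈O =
  𝕊-mono N⊆U s , inj₂ (K ∩ˢ O , K∩O , i<j , N∩O⊆N′ i i∈N i∈O , N∩O⊆N′ j j∈N j∈O , K∩O⊆N′ ,
                       i∉K ∘ inter-⊆ˡ K∩O i , j∉K ∘ inter-⊆ˡ K∩O j)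
  where
  K∩O = ∩ˢ-isInter K O
  K∩O⊆N′ : K ∩ˢ O ⊆ˢ _
  K∩O⊆N′ x x∈K∩O = let (x∈K , x∈O) = to (K∩O x) x∈K∩O in N∩O⊆N′ x (K⊆N x x∈K) x∈O

ascetic-amalgam-↓ : ∀ {O O′ N′} → N ⊆ˢ O → O ⊆ˢ U → (∀ x → x ∈ˢ N → x ∈ˢ O′ → x ∈ˢ N′) →
                    ((lift O U (𝕊 N) ∩ lift O′ U (𝕊 N′)) ↓ O) ≐ 𝕊 N
ascetic-amalgam-↓ {N = N} {U = U} {O} {O′} {N′} N⊆O O⊆U N∩O′⊆N′ = begin
  (lift O U (𝕊 N) ∩ lift O′ U (𝕊 N′)) ↓ O            ≈⟨ ↓-∩ ⟩
  (lift O U (𝕊 N) ↓ O) ∩ (lift O′ U (𝕊 N′) ↓ O)      ≈⟨ ∩-cong (lift-↓-self (𝕊-mono N⊆O) O⊆U) ≐-refl ⟩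
  𝕊 N ∩ (lift O′ U (𝕊 N′) ↓ O)                       ≈⟨ proj₁ , (λ s → s , 𝕊-⊆-lift N⊆U N∩O′⊆N′ s ,
                                                                           𝕊-mono N⊆O s) ⟩
  𝕊 N                                                ∎
  where
  open ≐-Reasoning
  N⊆U : N ⊆ˢ U
  N⊆U x = O⊆U x ∘ N⊆O x

-- lift N O X s unfolds to 𝕊 O s × InLift N X s
InLift : FinSet → Model → Model
InLift N X (i , j , K) = (i ∉ˢ N ⊎ j ∉ˢ N) ⊎ Σ FinSet λ K′ → IsInter K′ K N × X (i , j , K′)

copy-lift-⊆ : ∀ {O O′ N′} → IsBij f O O′ → N ⊆ˢ O → IsImage f N N′ →
              copy f (lift N O X) ⊆ lift N′ O′ (copy f X)
copy-lift-⊆ {f = f} {N = N} {X = X} {O} {O′} {N′} fb N⊆O imgN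
            c@(i , j , K , ((_ , i∈O , j∈O , K⊆O , _) , condition) , a<b , p , imgK) =
  copy-⊆𝕊 proj₁ (λ _ x∈O → x∈O) inj (bij⇒isImage fb) c , push condition
  where
  inj = bij-injective fb
  outside : ∀ x → x ∈ˢ O → x ∉ˢ N → f x ∉ˢ N′
  outside x x∈O x∉N = x∉N ∘ image-∈⁻ inj N⊆O imgN x x∈O
  push : InLift N X (i , j , K) → InLift N′ (copy f X) _
  push (inj₁ out) = inj₁ (samePair-any (_∉ˢ N′) p (Data.Sum.map (outside i i∈O) (outside j j∈O) out))
  push (inj₂ (K₀ , K₀=K∩N , x)) =
    inj₂ (_ , ∩ˢ-isInter _ N′ , i , j , K₀ , x , a<b , p ,
          image-inter inj K⊆O N⊆O imgK imgN K₀=K∩N (∩ˢ-isInter _ N′))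

copy-lift-⊇ : ∀ {O O′ N′} → IsBij f O O′ → N ⊆ˢ O → IsImage f N N′ → X ⊆ 𝕊 N →
              lift N′ O′ (copy f X) ⊆ copy f (lift N O X)
copy-lift-⊇ {f = f} {N = N} {X = X} {O} {O′} {N′} fb N⊆O imgN X⊆𝕊N {a , b , K₁} (s′ , condition)
  with copy-𝕊 fb .proj₂ s′
... | i , j , K , sO@(i<j , i∈O , j∈O , K⊆O , i∉K , j∉K) , a<b , p , imgK =
  i , j , K , (sO , pull condition) , a<b , p , imgK
  where
  inj = bij-injective fb
  pull : InLift N′ (copy f X) (a , b , K₁) → InLift N X (i , j , K)
  pull (inj₁ out) =
    inj₁ (Data.Sum.map (λ fi∉N′ → fi∉N′ ∘ image-∈ imgN i) (λ fj∉N′ → fj∉N′ ∘ image-∈ imgN j)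
                       (samePair-any (_∉ˢ N′) (samePair-sym p) out))
  pull (inj₂ (K₀′ , K₀′=K₁∩N′ , c)) =
    inj₂ (K ∩ˢ N , K∩N , copy-preimage X⊆𝕊N (injectiveOn-⊆ inj N⊆O) sN p
                           (image-inter inj K⊆O N⊆O imgK imgN K∩N K₀′=K₁∩N′) c)
    where
    K∩N = ∩ˢ-isInter K N
    ab∈N′ = copy-⊆𝕊 X⊆𝕊N N⊆O inj imgN c
    fij∈N′ = samePair-all (_∈ˢ N′) (samePair-sym p) (ab∈N′ .proj₂ .proj₁) (ab∈N′ .proj₂ .proj₂ .proj₁)
    sN : 𝕊 N (i , j , K ∩ˢ N)
    sN = i<j , image-∈⁻ inj N⊆O imgN i i∈O (fij∈N′ .proj₁) , image-∈⁻ inj N⊆O imgN j j∈O (fij∈N′ .proj₂) ,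
         inter-⊆ʳ K∩N , i∉K ∘ inter-⊆ˡ K∩N i , j∉K ∘ inter-⊆ˡ K∩N j

copy-lift : ∀ {O O′ N′} → IsBij f O O′ → N ⊆ˢ O → IsImage f N N′ → X ⊆ 𝕊 N →
            copy f (lift N O X) ≐ lift N′ O′ (copy f X)
copy-lift {X = X} fb N⊆O imgN X⊆𝕊N = copy-lift-⊆ {X = X} fb N⊆O imgN , copy-lift-⊇ fb N⊆O imgN X⊆𝕊N

-- Amalgamation

CrossIndep : FinSet → FinSet → FinSet → Model → Set
CrossIndep N M L Z = Indep (λ x → x ∈ˢ N × x ∉ˢ M) (λ x → x ∈ˢ M × x ∉ˢ N) (λ x → x ∈ˢ L) Z

Admissible : FinSet → FinSet → FinSet → ℕ → ℕ → FinSet → Set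
Admissible N M L i j L′ = ∀ x → x ∈ˢ L′ → ((x ∈ˢ N × x ∉ˢ M) ⊎ (x ∈ˢ M × x ∉ˢ N) ⊎ x ∈ˢ L) × x ≢ i × x ≢ j

admissible-⊆ : ∀ {L L′} → IsUnion U N M → L ⊆ˢ N →
               Admissible N M L i j L′ →
               L′ ⊆ˢ U
admissible-⊆ U=N∪M L⊆N admissible x x∈L′ with admissible x x∈L′ .proj₁
... | inj₁ (x∈N , _)        = union-⊆ˡ U=N∪M x x∈N
... | inj₂ (inj₁ (x∈M , _)) = union-⊆ʳ U=N∪M x x∈M
... | inj₂ (inj₂ x∈L)       = union-⊆ˡ U=N∪M x (L⊆N x x∈L)

cross-𝕊 : ∀ {L L′} → IsUnion U N M → L ⊆ˢ N → i ∈ˢ N → j ∈ˢ M → j ∉ˢ N →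
          Admissible N M L i j L′ →
          𝕊 U (ci i j L′)
cross-𝕊 {i = i} {j = j} U=N∪M L⊆N i∈N j∈M j∉N admissible =
  𝕊-ci i≢j (union-⊆ˡ U=N∪M i i∈N) (union-⊆ʳ U=N∪M j j∈M) (admissible-⊆ U=N∪M L⊆N admissible)
       (λ i∈L′ → admissible i i∈L′ .proj₂ .proj₁ refl) (λ j∈L′ → admissible j j∈L′ .proj₂ .proj₂ refl)
  where
  i≢j : i ≢ j
  i≢j refl = j∉N i∈N

crossIndep-𝕊 : ∀ {L} → IsUnion U N M → L ⊆ˢ N → CrossIndep N M L (𝕊 U)
crossIndep-𝕊 U=N∪M L⊆N i j L′ (i∈N , _) (j∈M , j∉N) _ admissible = cross-𝕊 U=N∪M L⊆N i∈N j∈M j∉N admissible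

𝕊-↓ : N ⊆ˢ U → (𝕊 U ↓ N) ≐ 𝕊 N
𝕊-↓ N⊆U = proj₂ , (λ s → 𝕊-mono N⊆U s , s)

module CopyRestriction {f O O′ L N} (fb : IsBij f O O′) (L=O∩O′ : IsInter L O O′)
                       (fixes : ∀ x → x ∈ˢ L → f x ≡ x) (N⊆O : N ⊆ˢ O) where

  fN : FinSet
  fN = image f N

  imgN : IsImage f N fN
  imgN = image-isImage f N

  restrict-isBij : IsBij f N fN
  restrict-isBij = image-∈ imgN , injectiveOn-⊆ (bij-injective fb) N⊆O , (λ y → to (imgN y))

  fN⊆O′ : fN ⊆ˢ O′
  fN⊆O′ = image-mono imgN N⊆O (bij⇒isImage fb)

  fN∩O⊆N : ∀ x → x ∈ˢ fN → x ∈ˢ O → x ∈ˢ N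
  fN∩O⊆N x x∈fN x∈O with to (imgN x) x∈fN
  ... | k , k∈N , fk≡x =
    subst (_∈ˢ N) (bij-injective fb k x (N⊆O k k∈N) x∈O (trans fk≡x (sym (fixes x x∈L)))) k∈N
    where x∈L = inter-intro L=O∩O′ x x∈O (fN⊆O′ x x∈fN)

  N∩O′⊆fN : ∀ x → x ∈ˢ N → x ∈ˢ O′ → x ∈ˢ fN
  N∩O′⊆fN x x∈N x∈O′ =
    subst (_∈ˢ fN) (fixes x (inter-intro L=O∩O′ x (N⊆O x x∈N) x∈O′)) (image-∈ imgN x x∈N)

  restrict-inter : IsInter (L ∩ˢ N) N fN
  restrict-inter x = mk⇔
    (λ x∈L∩N → let (x∈L , x∈N) = to (∩ˢ-isInter L N x) x∈L∩N in x∈N , N∩O′⊆fN x x∈N (inter-⊆ʳ L=O∩O′ x x∈L))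
    (λ (x∈N , x∈fN) → from (∩ˢ-isInter L N x) (inter-intro L=O∩O′ x (N⊆O x x∈N) (fN⊆O′ x x∈fN) , x∈N))

  N=O∩U₀ : ∀ {U₀} → IsUnion U₀ N fN → IsInter N O U₀
  N=O∩U₀ U₀=N∪fN x = mk⇔
    (λ x∈N → N⊆O x x∈N , union-⊆ˡ U₀=N∪fN x x∈N)
    (λ (x∈O , x∈U₀) → [ (λ x∈N → x∈N) , (λ x∈fN → fN∩O⊆N x x∈fN x∈O) ] (to (U₀=N∪fN x) x∈U₀))

  fN=O′∩U₀ : ∀ {U₀} → IsUnion U₀ N fN → IsInter fN O′ U₀
  fN=O′∩U₀ U₀=N∪fN x = mk⇔
    (λ x∈fN → fN⊆O′ x x∈fN , union-⊆ʳ U₀=N∪fN x x∈fN)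
    (λ (x∈O′ , x∈U₀) → [ (λ x∈N → N∩O′⊆fN x x∈N x∈O′) , (λ x∈fN → x∈fN) ] (to (U₀=N∪fN x) x∈U₀))

  restrict-fixes : ∀ x → x ∈ˢ L ∩ˢ N → f x ≡ x
  restrict-fixes x = fixes x ∘ inter-⊆ˡ (∩ˢ-isInter L N) x

crossIndep-lift : ∀ {O O′ L N N′ U₀ L₀} → IsUnion U O O′ → L ⊆ˢ O → IsInter N O U₀ → IsInter N′ O′ U₀ →
                  IsInter L₀ L N → CrossIndep N N′ L₀ Z → CrossIndep O O′ L (lift U₀ U Z)
crossIndep-lift {Z = Z} {O = O} {O′} {L} {N} {N′} {U₀} {L₀} U=O∪O′ L⊆O N=O∩U₀ N′=O′∩U₀ L₀=L∩N indep
                i j L′ (i∈O , i∉O′) (j∈O′ , j∉O) L⊆L′ admissible =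
  cross-𝕊 U=O∪O′ L⊆O i∈O j∈O′ j∉O admissible , inLift (i ∈ˢ? U₀) (j ∈ˢ? U₀)
  where
  inLift : Dec (i ∈ˢ U₀) → Dec (j ∈ˢ U₀) → InLift U₀ Z (ci i j L′)
  inLift (no i∉U₀) _         = inj₁ (samePair-any (_∉ˢ U₀) (samePair-⊓⊔ i j) (inj₁ i∉U₀))
  inLift (yes _)  (no j∉U₀) = inj₁ (samePair-any (_∉ˢ U₀) (samePair-⊓⊔ i j) (inj₂ j∉U₀))
  inLift (yes i∈U₀) (yes j∈U₀) =
    inj₂ (L′ ∩ˢ U₀ , L′∩U₀ ,
          indep i j (L′ ∩ˢ U₀) (inter-intro N=O∩U₀ i i∈O i∈U₀ , i∉O′ ∘ inter-⊆ˡ N′=O′∩U₀ i)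
                               (inter-intro N′=O′∩U₀ j j∈O′ j∈U₀ , j∉O ∘ inter-⊆ˡ N=O∩U₀ j)
                               L₀⊆L′∩U₀ admissible₀)
    where
    L′∩U₀ = ∩ˢ-isInter L′ U₀
    L₀⊆L′∩U₀ : ∀ x → x ∈ˢ L₀ → x ∈ˢ L′ ∩ˢ U₀
    L₀⊆L′∩U₀ x x∈L₀ =
      inter-intro L′∩U₀ x (L⊆L′ x (inter-⊆ˡ L₀=L∩N x x∈L₀)) (inter-⊆ʳ N=O∩U₀ x (inter-⊆ʳ L₀=L∩N x x∈L₀))
    admissible₀ : Admissible N N′ L₀ i j (L′ ∩ˢ U₀)
    admissible₀ x x∈L′∩U₀ = Data.Sum.map side (Data.Sum.map side′ inL) (adm .proj₁) , adm .proj₂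
      where
      adm = admissible x (inter-⊆ˡ L′∩U₀ x x∈L′∩U₀)
      x∈U₀ = inter-⊆ʳ L′∩U₀ x x∈L′∩U₀
      side : x ∈ˢ O × x ∉ˢ O′ → x ∈ˢ N × x ∉ˢ N′
      side (x∈O , x∉O′) = inter-intro N=O∩U₀ x x∈O x∈U₀ , x∉O′ ∘ inter-⊆ˡ N′=O′∩U₀ x
      side′ : x ∈ˢ O′ × x ∉ˢ O → x ∈ˢ N′ × x ∉ˢ N
      side′ (x∈O′ , x∉O) = inter-intro N′=O′∩U₀ x x∈O′ x∈U₀ , x∉O ∘ inter-⊆ˡ N=O∩U₀ x
      inL : x ∈ˢ L → x ∈ˢ L₀
      inL x∈L = inter-intro L₀=L∩N x x∈L (inter-intro N=O∩U₀ x (L⊆O x x∈L) x∈U₀)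

union-trichotomy : ∀ {L} → IsUnion U N M → IsInter L N M → ∀ x → x ∈ˢ U →
                   (x ∈ˢ N × x ∉ˢ M) ⊎ (x ∈ˢ M × x ∉ˢ N) ⊎ x ∈ˢ L
union-trichotomy {N = N} {M = M} U=N∪M L=N∩M x x∈U with x ∈ˢ? N | x ∈ˢ? M
... | yes x∈N | yes x∈M = inj₂ (inj₂ (inter-intro L=N∩M x x∈N x∈M))
... | yes x∈N | no x∉M  = inj₁ (x∈N , x∉M)
... | no x∉N  | yes x∈M = inj₂ (inj₁ (x∈M , x∉N))
... | no x∉N  | no x∉M  = ⊥-elim ([ x∉N , x∉M ] (to (U=N∪M x) x∈U))

crossIndep-copy : ∀ {N N₀ L₀ U₀ A₀ B B′ L} →
  IsUnion U₀ N N₀ → IsInter L₀ N N₀ → A₀ ⊆ˢ U₀ → IsBij h A₀ U → IsUnion U B B′ → L ⊆ˢ B →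
  (∀ x → x ∈ˢ L₀ → x ∈ˢ A₀ × h x ∈ˢ L) →
  (∀ x → x ∈ˢ A₀ → h x ∈ˢ B → h x ∉ˢ B′ → x ∉ˢ N₀) →
  (∀ x → x ∈ˢ A₀ → h x ∈ˢ B′ → h x ∉ˢ B → x ∉ˢ N) →
  CrossIndep N N₀ L₀ Z → CrossIndep B B′ L (copy h (Z ↓ A₀))
crossIndep-copy {h = h} {U = U} {Z = Z} {N} {N₀} {L₀} {U₀} {A₀} {B} {B′} {L}
                U₀=N∪N₀ L₀=N∩N₀ A₀⊆U₀ hb U=B∪B′ L⊆B L₀-to-L B-side B′-side indep
                a b L′ (a∈B , a∉B′) (b∈B′ , b∉B) L⊆L′ admissible
  with bij-surjective hb a (union-⊆ˡ U=B∪B′ a a∈B) | bij-surjective hb b (union-⊆ʳ U=B∪B′ b b∈B′)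
... | x , x∈A₀ , refl | x′ , x′∈A₀ , refl =
  copy-ci (indep x x′ L′₀ (x∈N , x∉N₀) (x′∈N₀ , x′∉N) L₀⊆L′₀ admissible₀ , s)
          (λ hx≡hx′ → a∉B′ (subst (_∈ˢ B′) (sym hx≡hx′) b∈B′))
          (preimage-isImage hb L′⊆U)
  where
  L′⊆U = admissible-⊆ U=B∪B′ L⊆B admissible
  L′₀ = preimage h A₀ L′
  x∉N₀ = B-side x x∈A₀ a∈B a∉B′
  x′∉N = B′-side x′ x′∈A₀ b∈B′ b∉B
  x∈N = [ (λ x∈N → x∈N) , (λ x∈N₀ → ⊥-elim (x∉N₀ x∈N₀)) ] (to (U₀=N∪N₀ x) (A₀⊆U₀ x x∈A₀))
  x′∈N₀ = [ (λ x′∈N → ⊥-elim (x′∉N x′∈N)) , (λ x′∈N₀ → x′∈N₀) ] (to (U₀=N∪N₀ x′) (A₀⊆U₀ x′ x′∈A₀))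
  L₀⊆L′₀ : ∀ z → z ∈ˢ L₀ → z ∈ˢ L′₀
  L₀⊆L′₀ z z∈L₀ = let (z∈A₀ , hz∈L) = L₀-to-L z z∈L₀ in from (∈-preimage h A₀ L′ z) (z∈A₀ , L⊆L′ (h z) hz∈L)
  admissible₀ : Admissible N N₀ L₀ x x′ L′₀
  admissible₀ z z∈L′₀ =
    union-trichotomy U₀=N∪N₀ L₀=N∩N₀ z (A₀⊆U₀ z z∈A₀) ,
    (λ { refl → admissible (h z) hz∈L′ .proj₂ .proj₁ refl }) ,
    (λ { refl → admissible (h z) hz∈L′ .proj₂ .proj₂ refl })
    where
    z∈A₀ = to (∈-preimage h A₀ L′ z) z∈L′₀ .proj₁
    hz∈L′ = to (∈-preimage h A₀ L′ z) z∈L′₀ .proj₂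
  s : 𝕊 A₀ (ci x x′ L′₀)
  s = 𝕊-ci (λ { refl → x∉N₀ x′∈N₀ }) x∈A₀ x′∈A₀ (preimage-⊆ h L′)
           (λ x∈L′₀ → admissible₀ x x∈L′₀ .proj₂ .proj₁ refl)
           (λ x′∈L′₀ → admissible₀ x′ x′∈L′₀ .proj₂ .proj₂ refl)

freshen : FinSet → FinSet → ℕ → ℕ
freshen L N x with x ∈ˢ? L
... | yes _ = x
... | no  _ = x + N

freshen-fixes : ∀ L N x → x ∈ˢ L → freshen L N x ≡ x
freshen-fixes L N x x∈L with x ∈ˢ? L
... | yes _   = refl
... | no x∉L = ⊥-elim (x∉L x∈L)

+-∉ : ∀ x N → x + N ∉ˢ N
+-∉ x N x+N∈N = <⇒≱ (∈ˢ⇒< x+N∈N) (m≤n+m N x)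

module Freshen {L N} (L⊆N : L ⊆ˢ N) where

  N₀ : FinSet
  N₀ = image (freshen L N) N

  N₀-isImage : IsImage (freshen L N) N N₀
  N₀-isImage = image-isImage (freshen L N) N

  freshen-cases : ∀ x → (x ∈ˢ L × freshen L N x ≡ x) ⊎ (x ∉ˢ L × freshen L N x ≡ x + N)
  freshen-cases x with x ∈ˢ? L
  ... | yes x∈L = inj₁ (x∈L , refl)
  ... | no x∉L  = inj₂ (x∉L , refl)

  N∩N₀⊆L : ∀ x → x ∈ˢ N → x ∈ˢ N₀ → x ∈ˢ L
  N∩N₀⊆L x x∈N x∈N₀ with to (N₀-isImage x) x∈N₀
  ... | k , _ , fk≡x with freshen-cases k
  ...   | inj₁ (k∈L , fk≡k) = subst (_∈ˢ L) (trans (sym fk≡k) fk≡x) k∈L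
  ...   | inj₂ (_ , fk≡k+N) = ⊥-elim (+-∉ k N (subst (_∈ˢ N) (trans (sym fk≡x) fk≡k+N) x∈N))

  freshen-isBij : IsBij (freshen L N) N N₀
  freshen-isBij = image-∈ N₀-isImage , injective , (λ y → to (N₀-isImage y))
    where
    injective : InjectiveOn (freshen L N) N
    injective x y x∈N y∈N fx≡fy with freshen-cases x | freshen-cases y
    ... | inj₁ (_ , fx≡x) | inj₁ (_ , fy≡y) = trans (sym fx≡x) (trans fx≡fy fy≡y)
    ... | inj₁ (_ , fx≡x) | inj₂ (_ , fy≡y+N) =
      ⊥-elim (+-∉ y N (subst (_∈ˢ N) (trans (sym fx≡x) (trans fx≡fy fy≡y+N)) x∈N))
    ... | inj₂ (_ , fx≡x+N) | inj₁ (_ , fy≡y) =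
      ⊥-elim (+-∉ x N (subst (_∈ˢ N) (trans (sym fy≡y) (trans (sym fx≡fy) fx≡x+N)) y∈N))
    ... | inj₂ (_ , fx≡x+N) | inj₂ (_ , fy≡y+N) =
      +-cancelʳ-≡ N x y (trans (sym fx≡x+N) (trans fx≡fy fy≡y+N))

  freshen-inter : IsInter L N N₀
  freshen-inter x = mk⇔
    (λ x∈L → L⊆N x x∈L , subst (_∈ˢ N₀) (freshen-fixes L N x x∈L) (image-∈ N₀-isImage x (L⊆N x x∈L)))
    (λ (x∈N , x∈N₀) → N∩N₀⊆L x x∈N x∈N₀)

-- Self-adhesion relative to a frame

module SelfAdhesion (F : Frame) (isF : IsFrame F) where

  variable
    L : FinSet

  frame-⊆𝕊 : F N X → X ⊆ 𝕊 N
  frame-⊆𝕊 = isF .proj₁ _ _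

  selfAdhesive-cong : X ≐ Y → SelfAdhesiveAt F N X L → SelfAdhesiveAt F N Y L
  selfAdhesive-cong X≐Y sa f M fb L=N∩M fixes with sa f M fb L=N∩M fixes
  ... | U , Z , U=N∪M , FZ , Z↓N , Z↓M , indep =
    U , Z , U=N∪M , FZ , ≐-trans Z↓N X≐Y , ≐-trans Z↓M (copy-cong X≐Y) , indep

  selfAdhesive-𝕊 : SelfAdhesiveAt F N (𝕊 N) L
  selfAdhesive-𝕊 {N = N} f M fb L=N∩M fixes =
    N ∪ˢ M , 𝕊 (N ∪ˢ M) , N∪M , isF .proj₂ _ , 𝕊-↓ (union-⊆ˡ N∪M) ,
    ≐-trans (𝕊-↓ (union-⊆ʳ N∪M)) (≐-sym (copy-𝕊 fb)) , crossIndep-𝕊 N∪M (inter-⊆ˡ L=N∩M)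
    where N∪M = ∪ˢ-isUnion N M

  selfAdhesive-∩ : ClosedInter F → X ⊆ 𝕊 N → Y ⊆ 𝕊 N →
                   SelfAdhesiveAt F N X L → SelfAdhesiveAt F N Y L → SelfAdhesiveAt F N (X ∩ Y) L
  selfAdhesive-∩ {X = X} {N = N} {Y = Y} closedInter X⊆𝕊N Y⊆𝕊N saX saY f M fb L=N∩M fixes
    with saX f M fb L=N∩M fixes | saY f M fb L=N∩M fixes
  ... | U , Z₁ , U=N∪M , FZ₁ , Z₁↓N , Z₁↓M , indep₁ | U′ , Z₂ , U′=N∪M , FZ₂ , Z₂↓N , Z₂↓M , indep₂ =
    U , Z₁ ∩ Z₂ , U=N∪M ,
    closedInter U Z₁ Z₂ FZ₁ (subst (λ V → F V Z₂) (union-unique U′=N∪M U=N∪M) FZ₂) ,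
    ≐-trans ↓-∩ (∩-cong Z₁↓N Z₂↓N) ,
    ≐-trans ↓-∩ (≐-trans (∩-cong Z₁↓M Z₂↓M) (≐-sym (copy-∩ X⊆𝕊N Y⊆𝕊N (bij-injective fb)))) ,
    λ i j L′ i∈ j∈ L⊆L′ admissible → indep₁ i j L′ i∈ j∈ L⊆L′ admissible , indep₂ i j L′ i∈ j∈ L⊆L′ admissible

  selfAdhesive-𝕊⊆ : ∀ {O} → ClosedInter F → ClosedLift F → ClosedAscetic F → N ⊆ˢ O →
                    SelfAdhesiveAt F O (𝕊 N) L
  selfAdhesive-𝕊⊆ {N = N} {O = O} closedInter closedLift closedAscetic N⊆O f O′ fb L=O∩O′ fixes =
    V , lift O V (𝕊 N) ∩ lift O′ V (𝕊 fN) , V=O∪O′ ,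
    closedInter V _ _ (closedLift O V (𝕊 N) O⊆V (closedAscetic N O (𝕊 N) N⊆O (isF .proj₂ N)))
                      (closedLift O′ V (𝕊 fN) O′⊆V (closedAscetic fN O′ (𝕊 fN) fN⊆O′ (isF .proj₂ fN))) ,
    ascetic-amalgam-↓ N⊆O O⊆V N∩O′⊆fN ,
    ≐-trans (↓-cong ∩-comm) (≐-trans (ascetic-amalgam-↓ fN⊆O′ O′⊆V fN∩O⊆N) (≐-sym (copy-𝕊 restrict-isBij))) ,
    λ i j L′ (i∈O , i∉O′) (j∈O′ , j∉O) _ admissible →
      let s = cross-𝕊 V=O∪O′ (inter-⊆ˡ L=O∩O′) i∈O j∈O′ j∉O admissible
      in (s , inj₁ (samePair-any (_∉ˢ O) (samePair-⊓⊔ i j) (inj₂ j∉O))) ,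
         (s , inj₁ (samePair-any (_∉ˢ O′) (samePair-⊓⊔ i j) (inj₁ i∉O′)))
    where
    open CopyRestriction fb L=O∩O′ fixes N⊆O
    V = O ∪ˢ O′
    V=O∪O′ = ∪ˢ-isUnion O O′
    O⊆V = union-⊆ˡ V=O∪O′
    O′⊆V = union-⊆ʳ V=O∪O′

  selfAdhesive-lift : ∀ {O} → ClosedLift F → Fsa F N X → N ⊆ˢ O → SelfAdhesiveAt F O (lift N O X) L
  selfAdhesive-lift {N = N} {X = X} {L = L} {O = O} closedLift (FX , sa) N⊆O f O′ fb L=O∩O′ fixes
    with sa (L ∩ˢ N) (inter-⊆ʳ (∩ˢ-isInter L N)) f (image f N) restrict-isBij restrict-inter restrict-fixes
    where open CopyRestriction fb L=O∩O′ fixes N⊆O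
  ... | U₀ , Z , U₀=N∪fN , FZ , Z↓N , Z↓fN , indep =
    V , lift U₀ V Z , V=O∪O′ ,
    closedLift U₀ V Z (union-least U₀=N∪fN (λ x → O⊆V x ∘ N⊆O x) (λ x → O′⊆V x ∘ fN⊆O′ x)) FZ ,
    ≐-trans (lift-↓ O⊆V (N=O∩U₀ U₀=N∪fN)) (lift-cong Z↓N) ,
    ≐-trans (lift-↓ O′⊆V (fN=O′∩U₀ U₀=N∪fN))
            (≐-trans (lift-cong Z↓fN) (≐-sym (copy-lift fb N⊆O imgN (frame-⊆𝕊 FX)))) ,
    crossIndep-lift {Z = Z} V=O∪O′ (inter-⊆ˡ L=O∩O′) (N=O∩U₀ U₀=N∪fN) (fN=O′∩U₀ U₀=N∪fN)
                    (∩ˢ-isInter L N) indep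
    where
    open CopyRestriction fb L=O∩O′ fixes N⊆O
    V = O ∪ˢ O′
    V=O∪O′ = ∪ˢ-isUnion O O′
    O⊆V = union-⊆ˡ V=O∪O′
    O′⊆V = union-⊆ʳ V=O∪O′

  module CopyOfMarginal {N A B L B′ : FinSet} {f : ℕ → ℕ} (g : ℕ → ℕ) (A⊆N : A ⊆ˢ N) (gb : IsBij g A B)
                        (fb : IsBij f B B′) (L=B∩B′ : IsInter L B B′) (fixes : ∀ x → x ∈ˢ L → f x ≡ x) where

    L₀ : FinSet
    L₀ = preimage g A L

    L₀⊆N : L₀ ⊆ˢ N
    L₀⊆N x = A⊆N x ∘ preimage-⊆ g L x

    g-L₀ : ∀ x → x ∈ˢ L₀ → g x ∈ˢ L
    g-L₀ x = proj₂ ∘ to (∈-preimage g A L x)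

    open Freshen L₀⊆N public

    g₀ : ℕ → ℕ
    g₀ = freshen L₀ N

    A₀ : FinSet
    A₀ = A ∪ˢ image g₀ A

    A₀-cases : ∀ x → x ∈ˢ A₀ → x ∈ˢ A ⊎ ∃[ y ] (y ∈ˢ A × y ∉ˢ L₀ × x ≡ y + N)
    A₀-cases x x∈A₀ with to (∪ˢ-isUnion A _ x) x∈A₀
    ... | inj₁ x∈A = inj₁ x∈A
    ... | inj₂ x∈g₀A with to (image-isImage g₀ A x) x∈g₀A
    ...   | y , y∈A , g₀y≡x with freshen-cases y
    ...     | inj₁ (y∈L₀ , g₀y≡y)  = inj₁ (subst (_∈ˢ A) (trans (sym g₀y≡y) g₀y≡x) y∈A)
    ...     | inj₂ (y∉L₀ , g₀y≡y+N) = inj₂ (y , y∈A , y∉L₀ , trans (sym g₀y≡x) g₀y≡y+N)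

    ψ : ℕ → ℕ
    ψ x with x ∈ˢ? N
    ... | yes _ = g x
    ... | no  _ = f (g (x ∸ N))

    ψ-inside : ∀ x → x ∈ˢ N → ψ x ≡ g x
    ψ-inside x x∈N with x ∈ˢ? N
    ... | yes _    = refl
    ... | no x∉N = ⊥-elim (x∉N x∈N)

    ψ-A : ∀ x → x ∈ˢ A → ψ x ≡ g x
    ψ-A x = ψ-inside x ∘ A⊆N x

    ψ-shifted : ∀ y → ψ (y + N) ≡ f (g y)
    ψ-shifted y with (y + N) ∈ˢ? N
    ... | yes y+N∈N = ⊥-elim (+-∉ y N y+N∈N)
    ... | no _       = cong (f ∘ g) (m+n∸n≡m y N)

    ψ∘g₀ : ∀ y → y ∈ˢ A → ψ (g₀ y) ≡ f (g y)
    ψ∘g₀ y y∈A with freshen-cases y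
    ... | inj₁ (y∈L₀ , g₀y≡y)  = trans (cong ψ g₀y≡y) (trans (ψ-A y y∈A) (sym (fixes (g y) (g-L₀ y y∈L₀))))
    ... | inj₂ (_ , g₀y≡y+N) = trans (cong ψ g₀y≡y+N) (ψ-shifted y)

    f∘g-∉ : ∀ y → y ∈ˢ A → y ∉ˢ L₀ → f (g y) ∉ˢ B
    f∘g-∉ y y∈A y∉L₀ fgy∈B = y∉L₀ (from (∈-preimage g A L y) (y∈A , subst (_∈ˢ L) (sym gy≡fgy) fgy∈L))
      where
      gy∈B = bij-∈ gb y y∈A
      fgy∈L = inter-intro L=B∩B′ (f (g y)) fgy∈B (bij-∈ fb (g y) gy∈B)
      gy≡fgy : g y ≡ f (g y)
      gy≡fgy = bij-injective fb (g y) (f (g y)) gy∈B fgy∈B (sym (fixes (f (g y)) fgy∈L))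

    ψ-maps : ∀ x → x ∈ˢ A₀ → ψ x ∈ˢ B ∪ˢ B′
    ψ-maps x x∈A₀ with A₀-cases x x∈A₀
    ... | inj₁ x∈A = subst (_∈ˢ _) (sym (ψ-A x x∈A)) (union-⊆ˡ (∪ˢ-isUnion B B′) (g x) (bij-∈ gb x x∈A))
    ... | inj₂ (y , y∈A , _ , refl) =
      subst (_∈ˢ _) (sym (ψ-shifted y))
            (union-⊆ʳ (∪ˢ-isUnion B B′) (f (g y)) (bij-∈ fb (g y) (bij-∈ gb y y∈A)))

    ψ-injective : InjectiveOn ψ A₀
    ψ-injective x x′ x∈A₀ x′∈A₀ ψx≡ψx′ with A₀-cases x x∈A₀ | A₀-cases x′ x′∈A₀
    ... | inj₁ x∈A | inj₁ x′∈A =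
      bij-injective gb x x′ x∈A x′∈A (trans (sym (ψ-A x x∈A)) (trans ψx≡ψx′ (ψ-A x′ x′∈A)))
    ... | inj₁ x∈A | inj₂ (y , y∈A , y∉L₀ , refl) =
      ⊥-elim (f∘g-∉ y y∈A y∉L₀
        (subst (_∈ˢ B) (trans (sym (ψ-A x x∈A)) (trans ψx≡ψx′ (ψ-shifted y))) (bij-∈ gb x x∈A)))
    ... | inj₂ (y , y∈A , y∉L₀ , refl) | inj₁ x′∈A =
      ⊥-elim (f∘g-∉ y y∈A y∉L₀
        (subst (_∈ˢ B) (trans (sym (ψ-A x′ x′∈A)) (trans (sym ψx≡ψx′) (ψ-shifted y))) (bij-∈ gb x′ x′∈A)))
    ... | inj₂ (y , y∈A , _ , refl) | inj₂ (y′ , y′∈A , _ , refl) =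
      cong (_+ N) (bij-injective gb y y′ y∈A y′∈A
        (bij-injective fb (g y) (g y′) (bij-∈ gb y y∈A) (bij-∈ gb y′ y′∈A)
          (trans (sym (ψ-shifted y)) (trans ψx≡ψx′ (ψ-shifted y′)))))

    ψ-surjective : ∀ u → u ∈ˢ B ∪ˢ B′ → ∃[ x ] (x ∈ˢ A₀ × ψ x ≡ u)
    ψ-surjective u u∈B∪B′ with to (∪ˢ-isUnion B B′ u) u∈B∪B′
    ... | inj₁ u∈B with bij-surjective gb u u∈B
    ...   | x , x∈A , refl = x , union-⊆ˡ (∪ˢ-isUnion A _) x x∈A , ψ-A x x∈A
    ψ-surjective u _ | inj₂ u∈B′ with bij-surjective fb u u∈B′
    ... | b , b∈B , refl with bij-surjective gb b b∈B
    ...   | y , y∈A , refl with freshen-cases y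
    ...     | inj₁ (y∈L₀ , _) =
      y , union-⊆ˡ (∪ˢ-isUnion A _) y y∈A , trans (ψ-A y y∈A) (sym (fixes (g y) (g-L₀ y y∈L₀)))
    ...     | inj₂ (_ , g₀y≡y+N) =
      y + N , union-⊆ʳ (∪ˢ-isUnion A _) (y + N) (subst (_∈ˢ _) g₀y≡y+N (image-∈ (image-isImage g₀ A) y y∈A)) ,
      ψ-shifted y

    ψ-isBij : IsBij ψ A₀ (B ∪ˢ B′)
    ψ-isBij = ψ-maps , ψ-injective , ψ-surjective

    ψ-L₀ : ∀ x → x ∈ˢ L₀ → ψ x ∈ˢ L
    ψ-L₀ x x∈L₀ = subst (_∈ˢ L) (sym (ψ-inside x (L₀⊆N x x∈L₀))) (g-L₀ x x∈L₀)

    B∖B′-∉N₀ : ∀ x → x ∈ˢ A₀ → ψ x ∈ˢ B → ψ x ∉ˢ B′ → x ∉ˢ N₀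
    B∖B′-∉N₀ x x∈A₀ _ ψx∉B′ with A₀-cases x x∈A₀
    ... | inj₁ x∈A = λ x∈N₀ → ψx∉B′ (inter-⊆ʳ L=B∩B′ (ψ x) (ψ-L₀ x (N∩N₀⊆L x (A⊆N x x∈A) x∈N₀)))
    ... | inj₂ (y , y∈A , _ , refl) =
      ⊥-elim (ψx∉B′ (subst (_∈ˢ B′) (sym (ψ-shifted y)) (bij-∈ fb (g y) (bij-∈ gb y y∈A))))

    B′∖B-∉N : ∀ x → x ∈ˢ A₀ → ψ x ∈ˢ B′ → ψ x ∉ˢ B → x ∉ˢ N
    B′∖B-∉N x x∈A₀ _ ψx∉B with A₀-cases x x∈A₀
    ... | inj₁ x∈A = ⊥-elim (ψx∉B (subst (_∈ˢ B) (sym (ψ-A x x∈A)) (bij-∈ gb x x∈A)))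
    ... | inj₂ (y , _ , _ , refl) = +-∉ y N

    module Glue {X U₀ Z₀} (X⊆𝕊N : X ⊆ 𝕊 N) (U₀=N∪N₀ : IsUnion U₀ N N₀)
                (Z₀↓N : (Z₀ ↓ N) ≐ X) (Z₀↓N₀ : (Z₀ ↓ N₀) ≐ copy g₀ X) where

      g₀A = image g₀ A

      A⊆A₀ : A ⊆ˢ A₀
      A⊆A₀ = union-⊆ˡ (∪ˢ-isUnion A g₀A)

      g₀A⊆A₀ : g₀A ⊆ˢ A₀
      g₀A⊆A₀ = union-⊆ʳ (∪ˢ-isUnion A g₀A)

      g₀A⊆N₀ : g₀A ⊆ˢ N₀
      g₀A⊆N₀ = image-mono (image-isImage g₀ A) A⊆N N₀-isImage

      A₀⊆U₀ : A₀ ⊆ˢ U₀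
      A₀⊆U₀ = union-least (∪ˢ-isUnion A g₀A) (λ x → union-⊆ˡ U₀=N∪N₀ x ∘ A⊆N x)
                                              (λ x → union-⊆ʳ U₀=N∪N₀ x ∘ g₀A⊆N₀ x)

      W : Model
      W = copy ψ (Z₀ ↓ A₀)

      ψA=B : IsImage ψ A B
      ψA=B = image-cong (λ _ x∈A → x∈A) (λ x x∈A → sym (ψ-A x x∈A)) (bij⇒isImage gb)

      ψg₀A=B′ : IsImage ψ g₀A B′
      ψg₀A=B′ = image-∘⁻ (image-isImage g₀ A)
                  (image-cong (λ _ x∈A → x∈A) (λ y y∈A → sym (ψ∘g₀ y y∈A))
                              (image-∘ (bij⇒isImage gb) (bij⇒isImage fb)))

      W↓B : (W ↓ B) ≐ copy g (X ↓ A)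
      W↓B = begin
        copy ψ (Z₀ ↓ A₀) ↓ B      ≈⟨ copy-↓ proj₂ A⊆A₀ ψ-injective ψA=B ⟨
        copy ψ ((Z₀ ↓ A₀) ↓ A)    ≈⟨ copy-cong (↓-↓ A⊆A₀) ⟩
        copy ψ (Z₀ ↓ A)           ≈⟨ copy-cong (↓-↓ A⊆N) ⟨
        copy ψ ((Z₀ ↓ N) ↓ A)     ≈⟨ copy-cong (↓-cong Z₀↓N) ⟩
        copy ψ (X ↓ A)            ≈⟨ copy-cong-on proj₂ ψ-A ⟩
        copy g (X ↓ A)            ∎
        where open ≐-Reasoning

      W↓B′ : (W ↓ B′) ≐ copy f (copy g (X ↓ A))
      W↓B′ = begin
        copy ψ (Z₀ ↓ A₀) ↓ B′     ≈⟨ copy-↓ proj₂ g₀A⊆A₀ ψ-injective ψg₀A=B′ ⟨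
        copy ψ ((Z₀ ↓ A₀) ↓ g₀A)  ≈⟨ copy-cong (↓-↓ g₀A⊆A₀) ⟩
        copy ψ (Z₀ ↓ g₀A)         ≈⟨ copy-cong (↓-↓ g₀A⊆N₀) ⟨
        copy ψ ((Z₀ ↓ N₀) ↓ g₀A)  ≈⟨ copy-cong (↓-cong Z₀↓N₀) ⟩
        copy ψ (copy g₀ X ↓ g₀A)  ≈⟨ copy-cong (copy-↓ X⊆𝕊N A⊆N (bij-injective freshen-isBij) (image-isImage g₀ A)) ⟨
        copy ψ (copy g₀ (X ↓ A))  ≈⟨ copy-∘ ⟨
        copy (ψ ∘ g₀) (X ↓ A)     ≈⟨ copy-cong-on proj₂ ψ∘g₀ ⟩
        copy (f ∘ g) (X ↓ A)      ≈⟨ copy-∘ ⟩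
        copy f (copy g (X ↓ A))   ∎
        where open ≐-Reasoning

      W-indep : CrossIndep N N₀ L₀ Z₀ → CrossIndep B B′ L W
      W-indep = crossIndep-copy U₀=N∪N₀ freshen-inter A₀⊆U₀ ψ-isBij (∪ˢ-isUnion B B′) (inter-⊆ˡ L=B∩B′)
                  (λ x x∈L₀ → A⊆A₀ x (preimage-⊆ g L x x∈L₀) , ψ-L₀ x x∈L₀) B∖B′-∉N₀ B′∖B-∉N

  selfAdhesive-copy-↓ : ∀ {g : ℕ → ℕ} → ClosedCopy F → ClosedMarg F → Fsa F N X → A ⊆ˢ N → IsBij g A B →
                        SelfAdhesiveAt F B (copy g (X ↓ A)) L
  selfAdhesive-copy-↓ {N = N} {X = X} {A = A} {B = B} {g = g} closedCopy closedMarg (FX , sa) A⊆N gb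
                      f B′ fb L=B∩B′ fixes
    with sa L₀ L₀⊆N (freshen L₀ N) N₀ freshen-isBij freshen-inter (freshen-fixes L₀ N)
    where open CopyOfMarginal g A⊆N gb fb L=B∩B′ fixes
  ... | U₀ , Z₀ , U₀=N∪N₀ , FZ₀ , Z₀↓N , Z₀↓N₀ , indep₀ =
    B ∪ˢ B′ , W , ∪ˢ-isUnion B B′ , closedCopy A₀ _ ψ _ ψ-isBij (closedMarg U₀ A₀ Z₀ A₀⊆U₀ FZ₀) ,
    W↓B , W↓B′ , W-indep indep₀
    where
    open CopyOfMarginal g A⊆N gb fb L=B∩B′ fixes
    open Glue (frame-⊆𝕊 FX) U₀=N∪N₀ Z₀↓N Z₀↓N₀

  Fsa-isFrame : IsFrame (Fsa F)
  Fsa-isFrame = (λ N X → isF .proj₁ N X ∘ proj₁) , λ N → isF .proj₂ N , λ L _ → selfAdhesive-𝕊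

  Fsa-closedCopy : ClosedCopy F → ClosedMarg F → ClosedCopy (Fsa F)
  Fsa-closedCopy closedCopy closedMarg N M f X fb FsaX@(FX , _) =
    closedCopy N M f X fb FX ,
    λ L _ → selfAdhesive-cong (copy-cong (↓-self (frame-⊆𝕊 FX)))
                              (selfAdhesive-copy-↓ closedCopy closedMarg FsaX (λ _ x∈N → x∈N) fb)

  Fsa-closedMarg : ClosedCopy F → ClosedMarg F → ClosedMarg (Fsa F)
  Fsa-closedMarg closedCopy closedMarg N M X M⊆N FsaX@(FX , _) =
    closedMarg N M X M⊆N FX ,
    λ L _ → selfAdhesive-cong (copy-id proj₂) (selfAdhesive-copy-↓ closedCopy closedMarg FsaX M⊆N id-isBij)

  Fsa-closedInter : ClosedInter F → ClosedInter (Fsa F)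
  Fsa-closedInter closedInter N X Y (FX , saX) (FY , saY) =
    closedInter N X Y FX FY ,
    λ L L⊆N → selfAdhesive-∩ closedInter (frame-⊆𝕊 FX) (frame-⊆𝕊 FY) (saX L L⊆N) (saY L L⊆N)

  Fsa-closedLift : ClosedLift F → ClosedLift (Fsa F)
  Fsa-closedLift closedLift N O X N⊆O FsaX@(FX , _) =
    closedLift N O X N⊆O FX , λ L _ → selfAdhesive-lift closedLift FsaX N⊆O

  Fsa-closedAscetic : ClosedInter F → ClosedLift F → ClosedAscetic F → ClosedAscetic (Fsa F)
  Fsa-closedAscetic closedInter closedLift closedAscetic N M X N⊆M FsaX@(FX , _) =
    closedAscetic N M X N⊆M FX ,
    λ L _ → selfAdhesive-cong (lift-↓-self (frame-⊆𝕊 FX) N⊆M)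
                              (selfAdhesive-∩ closedInter proj₁ (𝕊-mono N⊆M)
                                              (selfAdhesive-lift closedLift FsaX N⊆M)
                                              (selfAdhesive-𝕊⊆ closedInter closedLift closedAscetic N⊆M))

lemma5p1 : (F : Frame) → IsFrame F → ClosedCopy F → ClosedMarg F →
    (IsFrame (Fsa F) × ClosedCopy (Fsa F) × ClosedMarg (Fsa F)) ×
    (ClosedInter F → ClosedInter (Fsa F)) ×
    (ClosedLift F → ClosedLift (Fsa F)) ×
    (ClosedInter F → ClosedLift F → ClosedAscetic F →
      ClosedInter (Fsa F) × ClosedLift (Fsa F) × ClosedAscetic (Fsa F))
lemma5p1 F isF closedCopy closedMarg =
  (Fsa-isFrame , Fsa-closedCopy closedCopy closedMarg , Fsa-closedMarg closedCopy closedMarg) ,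
  Fsa-closedInter ,
  Fsa-closedLift ,
  λ closedInter closedLift closedAscetic →
    Fsa-closedInter closedInter , Fsa-closedLift closedLift ,
    Fsa-closedAscetic closedInter closedLift closedAscetic
  where open SelfAdhesion F isF
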